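{- Let $P$ and $Q$ be finite posets, with $P$ a forest, and $k$ a field. Define $\alpha:\mathrm{Hom}(P,Q)\to\mathrm{Pro}(P,Q)$ by $\alpha(g)(p)=Q\setminus\{q\in Q: q\ge g(p)\}$. Then (a) the down-set of $\mathrm{Pro}(P,Q)$ generated by $\alpha(\mathrm{Hom}(P,Q))$ equals $\mathrm{Pro}^{<\infty}(P,Q)$; and (b) the isotonian ideal satisfies $L(P,Q)=L_\Gamma(\mathrm{Pro}^{<\infty}(P,Q))$.
   Context: A poset $P$ is a forest if for any two incomparable $p_1,p_2\in P$ there is no $p\in P$ with $p\le p_1$ and $p\le p_2$. $\mathrm{Hom}(P,Q)$ is the set of order-preserving maps $P\to Q$. $\widehat{Q}$ is the set of down-sets of $Q$ ordered by inclusion; a profunctor $f:P\to Q$ is an order-preserving map $f:P\to\widehat{Q}$; $\mathrm{Pro}(P,Q)$ is ordered pointwise by inclusion; $\mathrm{Pro}^{<\infty}(P,Q)=\{f: f(p)\neq Q\ \forall p\}$. The graph is $\Gamma f=\{(q,p)\in Q\times P: q\text{ minimal in } Q\setminus f(p)\}$. In $k[x_{p,q}:(p,q)\in P\times Q]$: the isotonian ideal $L(P,Q)$ is generated by the monomials $\prod_{p\in P}x_{p,g(p)}$ for $g\in\mathrm{Hom}(P,Q)$, and $L_\Gamma(\mathcal{I})$ is generated by $\prod_{(q,p)\in\Gamma f}x_{p,q}$ for $f\in\mathcal{I}$. -}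

module Defs where

open import Level using (0ℓ)
open import Data.Nat using (ℕ; _≤_)
open import Data.Fin using (Fin)
open import Data.Fin.Properties using (_≟_; all?)
open import Data.Fin.Subset using (Subset; _∈_; _∉_; _⊆_)
open import Data.Fin.Subset.Properties using (_∈?_)
open import Data.Vec using (tabulate)
open import Data.Bool using (Bool; true; false)
open import Data.Product using (Σ; ∃; _×_; _,_)
open import Relation.Nullary using (¬_; Dec; yes; no; does; ¬?)
open import Relation.Nullary.Decidable using (_→-dec_; _×-dec_)
open import Relation.Binary using (IsPartialOrder; Decidable)
open import Relation.Binary.PropositionalEquality using (_≡_; _≢_)

record FinPoset : Set₁ where
  field
    size   : ℕ
    _≼_    : Fin size → Fin size → Set
    isPO   : IsPartialOrder _≡_ _≼_
    _≼?_   : Decidable _≼_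

open FinPoset public

El : FinPoset → Set
El P = Fin (size P)

IsForest : FinPoset → Set
IsForest P = ∀ p₁ p₂ → ¬ (_≼_ P p₁ p₂) → ¬ (_≼_ P p₂ p₁) →
             ¬ (∃ λ p → _≼_ P p p₁ × _≼_ P p p₂)

IsMonotone : (P Q : FinPoset) → (El P → El Q) → Set
IsMonotone P Q g = ∀ {p p'} → _≼_ P p p' → _≼_ Q (g p) (g p')

IsDownSet : (Q : FinPoset) → Subset (size Q) → Set
IsDownSet Q S = ∀ {q q'} → _≼_ Q q' q → q ∈ S → q' ∈ S

-- Profunctors P → Q: order-preserving maps P → Q̂ (Q̂ ordered by ⊆).
IsProfunctor : (P Q : FinPoset) → (El P → Subset (size Q)) → Set
IsProfunctor P Q f = (∀ p → IsDownSet Q (f p)) × (∀ {p p'} → _≼_ P p p' → f p ⊆ f p')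

_≤Pro_ : ∀ {n m} → (Fin n → Subset m) → (Fin n → Subset m) → Set
f ≤Pro f' = ∀ p → f p ⊆ f' p

IsFiniteValued : (Q : FinPoset) → ∀ {n} → (Fin n → Subset (size Q)) → Set
IsFiniteValued Q f = ∀ p → ¬ (∀ q → q ∈ f p)

α : (P Q : FinPoset) → (El P → El Q) → El P → Subset (size Q)
α P Q g p = tabulate (λ q → does (¬? (_≼?_ Q (g p) q)))

-- Monomials in k[x_{p,q} : (p,q) ∈ P × Q], as exponent vectors.

Monomial : (P Q : FinPoset) → Set
Monomial P Q = El P → El Q → ℕ

_∣ₘ_ : ∀ {P Q} → Monomial P Q → Monomial P Q → Set
_∣ₘ_ {P} {Q} e m = ∀ (p : El P) (q : El Q) → e p q ≤ m p q

InMonomialIdeal : (P Q : FinPoset) → (Monomial P Q → Set) → Monomial P Q → Set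
InMonomialIdeal P Q Gens m = ∃ λ (e : Monomial P Q) → Gens e × _∣ₘ_ {P} {Q} e m

indicator : ∀ {A : Set} → Dec A → ℕ
indicator (yes _) = 1
indicator (no _)  = 0

homMonomial : (P Q : FinPoset) → (El P → El Q) → Monomial P Q
homMonomial P Q g p q = indicator (g p ≟ q)

LGens : (P Q : FinPoset) → Monomial P Q → Set
LGens P Q e = ∃ λ (g : El P → El Q) → IsMonotone P Q g × (∀ p q → e p q ≡ homMonomial P Q g p q)

InGraph : (P Q : FinPoset) → (El P → Subset (size Q)) → El Q → El P → Set
InGraph P Q f q p = q ∉ f p × (∀ q' → _≼_ Q q' q → q' ≢ q → q' ∈ f p)

InGraph? : (P Q : FinPoset) → (f : El P → Subset (size Q)) → ∀ q p → Dec (InGraph P Q f q p)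
InGraph? P Q f q p =
  ¬? (q ∈? f p) ×-dec all? (λ q' → _≼?_ Q q' q →-dec (¬? (q' ≟ q) →-dec (q' ∈? f p)))

graphMonomial : (P Q : FinPoset) → (El P → Subset (size Q)) → Monomial P Q
graphMonomial P Q f p q = indicator (InGraph? P Q f q p)

LΓProFinGens : (P Q : FinPoset) → Monomial P Q → Set
LΓProFinGens P Q e = ∃ λ (f : El P → Subset (size Q)) →
  IsProfunctor P Q f × IsFiniteValued Q f × (∀ p q → e p q ≡ graphMonomial P Q f p q)

-- In a forest the strict upper bounds of an element form a chain, so every
-- non-maximal p has a parent, its least strict upper bound.  Given f in
-- Pro^{<∞}(P,Q), a monotone g : P → Q with g(p) minimal in Q ∖ f(p) is then
-- built from the roots downwards: g(p) is a minimal element of Q ∖ f(p) below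
-- g(parent p), which lies in Q ∖ f(p) because f(p) ⊆ f(parent p).  Such a g
-- gives f ≤ α(g), as the f(p) are down-sets, and its monomial divides the
-- graph monomial of f.  Conversely α(g) is finite-valued and its graph is
-- exactly the graph of g.
module Submission where

open import Defs
open import Data.Fin.Subset using (Subset)
open import Data.Product using (∃; _×_)
open import Function.Bundles using (_⇔_)

open import Data.Bool using (true)
open import Data.Empty using (⊥-elim)
open import Data.Fin using (Fin)
open import Data.Fin.Induction using (po-wellFounded; po-noetherian)
open import Data.Fin.Properties using (_≟_; any?; ¬∀⟶∃¬)
open import Data.Fin.Subset using (_∈_; _∉_; _⊆_)
open import Data.Fin.Subset.Properties using (_∈?_)
open import Data.Nat using (z≤n) renaming (_≤_ to _≤ℕ_)
open import Data.Nat.Properties using (≤-refl; ≤-antisym) renaming (≤-trans to ≤ℕ-trans)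
open import Data.Product using (_,_; proj₁; proj₂)
open import Data.Sum using (_⊎_; inj₁; inj₂)
open import Data.Vec using (tabulate)
open import Data.Vec.Properties using (lookup∘tabulate; []=⇒lookup; lookup⇒[]=)
open import Function using (flip)
open import Function.Bundles using (mk⇔; Equivalence)
open import Induction.WellFounded using (Acc; acc; WellFounded)
open import Relation.Binary using (IsPartialOrder; Decidable)
open import Relation.Binary.PropositionalEquality using (_≡_; _≢_; refl; sym; trans; cong; subst)
open import Relation.Nullary using (¬_; Dec; yes; no; does; ¬?)
open import Relation.Nullary.Decidable using (_×-dec_; dec-true; decidable-stable)
import Relation.Binary.Construct.NonStrictToStrict as NonStrictToStrict

does-true : ∀ {A : Set} (a? : Dec A) → does a? ≡ true → A
does-true (yes a) _ = a

∈-tabulate-does : ∀ {n} {A : Fin n → Set} (A? : ∀ x → Dec (A x)) {x : Fin n} →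
                  x ∈ tabulate (λ y → does (A? y)) ⇔ A x
∈-tabulate-does A? {x} = mk⇔
  (λ x∈ → does-true (A? x) (trans (sym (lookup∘tabulate _ x)) ([]=⇒lookup x∈)))
  (λ a → lookup⇒[]= x _ (trans (lookup∘tabulate _ x) (dec-true (A? x) a)))

indicator-mono : ∀ {A B : Set} (a? : Dec A) (b? : Dec B) → (A → B) → indicator a? ≤ℕ indicator b?
indicator-mono (yes _) (yes _) _   = ≤-refl
indicator-mono (yes a) (no ¬b) A→B = ⊥-elim (¬b (A→B a))
indicator-mono (no _)  _       _   = z≤n

indicator-cong : ∀ {A B : Set} (a? : Dec A) (b? : Dec B) → A ⇔ B → indicator a? ≡ indicator b?
indicator-cong a? b? A⇔B =
  ≤-antisym (indicator-mono a? b? (Equivalence.to A⇔B)) (indicator-mono b? a? (Equivalence.from A⇔B))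

module Order (X : FinPoset) where
  open IsPartialOrder (isPO X) public
    using (antisym) renaming (refl to ≼-refl; reflexive to ≼-reflexive; trans to ≼-trans)

  _<_ : El X → El X → Set
  _<_ = NonStrictToStrict._<_ _≡_ (_≼_ X)

  _<?_ : Decidable _<_
  _<?_ = NonStrictToStrict.<-decidable _≡_ (_≼_ X) _≟_ (_≼?_ X)

  <-wellFounded : WellFounded _<_
  <-wellFounded = po-wellFounded (isPO X)

  >-wellFounded : WellFounded (flip _<_)
  >-wellFounded = po-noetherian (isPO X)

IsMinimal : (X : FinPoset) → (El X → Set) → El X → Set
IsMinimal X U m = U m × (∀ x → _≼_ X x m → x ≢ m → ¬ U x)

module MinimalBelow (X : FinPoset) {U : El X → Set} (U? : ∀ x → Dec (U x)) where
  open Order X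

  private
    descend : (x : El X) → Acc _<_ x → El X
    descend x (acc rs) with any? (λ z → U? z ×-dec (z <? x))
    ... | yes (z , _ , z<x) = descend z (rs z<x)
    ... | no _              = x

    descend-spec : ∀ x a → U x → _≼_ X (descend x a) x × IsMinimal X U (descend x a)
    descend-spec x (acc rs) ux with any? (λ z → U? z ×-dec (z <? x))
    ... | yes (z , uz , z<x) =
      let (d≼z , d-minimal) = descend-spec z (rs z<x) uz in ≼-trans d≼z (proj₁ z<x) , d-minimal
    ... | no none = ≼-refl , ux , λ z z≼x z≢x uz → none (z , uz , z≼x , z≢x)

  -- Junk value x when ¬ U x; taking no proof of U x keeps the value proof-independent.
  minimalBelow : El X → El X
  minimalBelow x = descend x (<-wellFounded x)

  minimalBelow-≼ : ∀ {x} → U x → _≼_ X (minimalBelow x) x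
  minimalBelow-≼ {x} ux = proj₁ (descend-spec x (<-wellFounded x) ux)

  minimalBelow-isMinimal : ∀ {x} → U x → IsMinimal X U (minimalBelow x)
  minimalBelow-isMinimal {x} ux = proj₂ (descend-spec x (<-wellFounded x) ux)

module Forest (P : FinPoset) (forest : IsForest P) where
  open Order P

  upperBounds-comparable : ∀ {p a b} → _≼_ P p a → _≼_ P p b → _≼_ P a b ⊎ _≼_ P b a
  upperBounds-comparable {p} {a} {b} p≼a p≼b with _≼?_ P a b | _≼?_ P b a
  ... | yes a≼b | _       = inj₁ a≼b
  ... | no _    | yes b≼a = inj₂ b≼a
  ... | no a⋠b  | no b⋠a  = ⊥-elim (forest a b a⋠b b⋠a (p , p≼a , p≼b))

  data RootOrChild (p : El P) : Set where
    root  : (∀ u → ¬ (p < u)) → RootOrChild p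
    child : ∀ u → p < u → (∀ v → p < v → _≼_ P u v) → RootOrChild p

  rootOrChild : ∀ p → RootOrChild p
  rootOrChild p with any? (λ u → p <? u)
  ... | no none       = root (λ u p<u → none (u , p<u))
  ... | yes (x , p<x) = child u p<u u-least
    where
    open MinimalBelow P (λ v → p <? v)

    u : El P
    u = minimalBelow x

    p<u : p < u
    p<u = proj₁ (minimalBelow-isMinimal p<x)

    u-least : ∀ v → p < v → _≼_ P u v
    u-least v p<v with upperBounds-comparable (proj₁ p<u) (proj₁ p<v)
    ... | inj₁ u≼v = u≼v
    ... | inj₂ v≼u with v ≟ u
    ...   | yes refl = ≼-refl
    ...   | no v≢u   = ⊥-elim (proj₂ (minimalBelow-isMinimal p<x) v v≼u v≢u p<v)

module MonotoneMinimalChoice (P Q : FinPoset) (forest : IsForest P)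
    {U : El P → El Q → Set} (U? : ∀ p q → Dec (U p q))
    (U-antitone : ∀ {p u q} → _≼_ P p u → U u q → U p q)
    (U-inhabited : ∀ p → ∃ (U p)) where
  open Forest P forest
  open Order P using (_<_; >-wellFounded)
  open Order Q using (≼-reflexive; ≼-trans)
  open MinimalBelow Q

  private
    choose : (p : El P) → Acc (flip _<_) p → El Q
    choose p (acc rs) with rootOrChild p
    ... | root _        = minimalBelow (U? p) (proj₁ (U-inhabited p))
    ... | child u p<u _ = minimalBelow (U? p) (choose u (rs p<u))

    choose-irrelevant : ∀ p a a' → choose p a ≡ choose p a'
    choose-irrelevant p (acc rs) (acc rs') with rootOrChild p
    ... | root _        = refl
    ... | child u p<u _ = cong (minimalBelow (U? p)) (choose-irrelevant u (rs p<u) (rs' p<u))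

    choose-isMinimal : ∀ p a → IsMinimal Q (U p) (choose p a)
    choose-isMinimal p (acc rs) with rootOrChild p
    ... | root _        = minimalBelow-isMinimal (U? p) (proj₂ (U-inhabited p))
    ... | child u p<u _ =
      minimalBelow-isMinimal (U? p) (U-antitone (proj₁ p<u) (proj₁ (choose-isMinimal u (rs p<u))))

    choose-monotone : ∀ p a u a' → _≼_ P p u → _≼_ Q (choose p a) (choose u a')
    choose-strictlyMonotone : ∀ p a u a' → p < u → _≼_ Q (choose p a) (choose u a')

    choose-monotone p a u a' p≼u with p ≟ u
    ... | yes refl = ≼-reflexive (choose-irrelevant p a a')
    ... | no p≢u   = choose-strictlyMonotone p a u a' (p≼u , p≢u)

    choose-strictlyMonotone p (acc rs) u a' p<u with rootOrChild p
    ... | root p-maximal      = ⊥-elim (p-maximal u p<u)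
    ... | child v p<v v-least =
      ≼-trans (minimalBelow-≼ (U? p) (U-antitone (proj₁ p<v) (proj₁ (choose-isMinimal v (rs p<v)))))
              (choose-monotone v (rs p<v) u a' (v-least u p<u))

  monotoneMinimalChoice : ∃ λ (g : El P → El Q) → IsMonotone P Q g × (∀ p → IsMinimal Q (U p) (g p))
  monotoneMinimalChoice =
    (λ p → choose p (>-wellFounded p)) ,
    (λ {p} {u} p≼u → choose-monotone p (>-wellFounded p) u (>-wellFounded u) p≼u) ,
    (λ p → choose-isMinimal p (>-wellFounded p))
isFiniteValued-antitone : ∀ Q {n} {f f' : Fin n → Subset (size Q)} →
                          f ≤Pro f' → IsFiniteValued Q f' → IsFiniteValued Q f
isFiniteValued-antitone Q f≤f' f'-finite p all∈f = f'-finite p (λ q → f≤f' p (all∈f q))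

module _ (P Q : FinPoset) where

  isMinimal-∉⇒inGraph : ∀ {f : El P → Subset (size Q)} {p q} →
                         IsMinimal Q (_∉ f p) q → InGraph P Q f q p
  isMinimal-∉⇒inGraph {f} {p} (q∉fp , below-q∈fp) =
    q∉fp , λ q' q'≼q q'≢q → decidable-stable (q' ∈? f p) (below-q∈fp q' q'≼q q'≢q)

  graphSection : IsForest P → ∀ {f : El P → Subset (size Q)} →
                 (∀ {p p'} → _≼_ P p p' → f p ⊆ f p') → IsFiniteValued Q f →
                 ∃ λ (g : El P → El Q) → IsMonotone P Q g × (∀ p → InGraph P Q f (g p) p)
  graphSection forest {f} f-mono f-finite =
    let (g , g-mono , g-minimal) = monotoneMinimalChoice
    in  g , g-mono , λ p → isMinimal-∉⇒inGraph {f} (g-minimal p)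
    where
    open MonotoneMinimalChoice P Q forest (λ p q → ¬? (q ∈? f p))
      (λ p≼u q∉fu q∈fp → q∉fu (f-mono p≼u q∈fp))
      (λ p → ¬∀⟶∃¬ (size Q) (_∈ f p) (_∈? f p) (f-finite p))

  module _ (g : El P → El Q) where
    open Order Q using (antisym; ≼-refl; ≼-trans)

    ∈-α⁺ : ∀ {p q} → ¬ _≼_ Q (g p) q → q ∈ α P Q g p
    ∈-α⁺ {p} = Equivalence.from (∈-tabulate-does (λ q → ¬? (_≼?_ Q (g p) q)))

    ∈-α⁻ : ∀ {p q} → q ∈ α P Q g p → ¬ _≼_ Q (g p) q
    ∈-α⁻ {p} = Equivalence.to (∈-tabulate-does (λ q → ¬? (_≼?_ Q (g p) q)))

    ∉-α : ∀ p → g p ∉ α P Q g p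
    ∉-α p gp∈α = ∈-α⁻ gp∈α ≼-refl

    α-isFiniteValued : IsFiniteValued Q (α P Q g)
    α-isFiniteValued p all∈α = ∉-α p (all∈α (g p))

    α-isProfunctor : IsMonotone P Q g → IsProfunctor P Q (α P Q g)
    α-isProfunctor g-mono =
      (λ p q'≼q q∈α → ∈-α⁺ (λ gp≼q' → ∈-α⁻ q∈α (≼-trans gp≼q' q'≼q))) ,
      (λ p≼p' q∈α → ∈-α⁺ (λ gp'≼q → ∈-α⁻ q∈α (≼-trans (g-mono p≼p') gp'≼q)))

    ≤Pro-α : ∀ {f : El P → Subset (size Q)} → (∀ p → IsDownSet Q (f p)) →
             (∀ p → g p ∉ f p) → f ≤Pro α P Q g
    ≤Pro-α f-down gp∉fp p q∈fp = ∈-α⁺ (λ gp≼q → gp∉fp p (f-down p gp≼q q∈fp))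

    inGraph-α : ∀ {p q} → InGraph P Q (α P Q g) q p ⇔ (g p ≡ q)
    inGraph-α {p} {q} = mk⇔ to from
      where
      to : InGraph P Q (α P Q g) q p → g p ≡ q
      to (q∉α , below-q∈α) =
        decidable-stable (g p ≟ q) (λ gp≢q → ∉-α p (below-q∈α (g p) gp≼q gp≢q))
        where
        gp≼q : _≼_ Q (g p) q
        gp≼q = decidable-stable (_≼?_ Q (g p) q) (λ gp⋠q → q∉α (∈-α⁺ gp⋠q))

      from : g p ≡ q → InGraph P Q (α P Q g) q p
      from refl = ∉-α p , λ q' q'≼gp q'≢gp → ∈-α⁺ (λ gp≼q' → q'≢gp (antisym q'≼gp gp≼q'))

    graphMonomial-α : ∀ p q → graphMonomial P Q (α P Q g) p q ≡ homMonomial P Q g p q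
    graphMonomial-α p q = indicator-cong (InGraph? P Q (α P Q g) q p) (g p ≟ q) inGraph-α

    homMonomial-∣-graphMonomial : ∀ {f : El P → Subset (size Q)} → (∀ p → InGraph P Q f (g p) p) →
                                  _∣ₘ_ {P} {Q} (homMonomial P Q g) (graphMonomial P Q f)
    homMonomial-∣-graphMonomial {f} g∈Γf p q =
      indicator-mono (g p ≟ q) (InGraph? P Q f q p) (λ { refl → g∈Γf p })

  below-α⇒isFiniteValued : ∀ {f : El P → Subset (size Q)} →
                           (∃ λ (g : El P → El Q) → IsMonotone P Q g × f ≤Pro α P Q g) →
                           IsFiniteValued Q f
  below-α⇒isFiniteValued (g , _ , f≤αg) = isFiniteValued-antitone Q f≤αg (α-isFiniteValued g)

  isFiniteValued⇒below-α : IsForest P → ∀ {f : El P → Subset (size Q)} →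
                           IsProfunctor P Q f → IsFiniteValued Q f →
                           ∃ λ (g : El P → El Q) → IsMonotone P Q g × f ≤Pro α P Q g
  isFiniteValued⇒below-α forest (f-down , f-mono) f-finite with graphSection forest f-mono f-finite
  ... | g , g-mono , g∈Γf = g , g-mono , ≤Pro-α g f-down (λ p → proj₁ (g∈Γf p))

  ∣ₘ-trans : ∀ {e e' e''} → _∣ₘ_ {P} {Q} e e' → _∣ₘ_ {P} {Q} e' e'' → _∣ₘ_ {P} {Q} e e''
  ∣ₘ-trans e∣e' e'∣e'' p q = ≤ℕ-trans (e∣e' p q) (e'∣e'' p q)

  InMonomialIdeal-⊆ : ∀ {G G' : Monomial P Q → Set} →
                      (∀ {e} → G e → InMonomialIdeal P Q G' e) →
                      ∀ {m} → InMonomialIdeal P Q G m → InMonomialIdeal P Q G' m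
  InMonomialIdeal-⊆ G⊆I' (e , Ge , e∣m) =
    let (e' , G'e' , e'∣e) = G⊆I' Ge in e' , G'e' , ∣ₘ-trans e'∣e e∣m

  LGens⊆LΓProFin : ∀ {e} → LGens P Q e → InMonomialIdeal P Q (LΓProFinGens P Q) e
  LGens⊆LΓProFin {e} (g , g-mono , e≡) =
    e , (α P Q g , α-isProfunctor g g-mono , α-isFiniteValued g ,
         λ p q → trans (e≡ p q) (sym (graphMonomial-α g p q))) ,
    λ p q → ≤-refl

  LΓProFinGens⊆L : IsForest P → ∀ {e} → LΓProFinGens P Q e → InMonomialIdeal P Q (LGens P Q) e
  LΓProFinGens⊆L forest (f , (_ , f-mono) , f-finite , e≡) with graphSection forest f-mono f-finite
  ... | g , g-mono , g∈Γf =
    homMonomial P Q g , (g , g-mono , λ _ _ → refl) ,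
    λ p q → subst (homMonomial P Q g p q ≤ℕ_) (sym (e≡ p q)) (homMonomial-∣-graphMonomial g g∈Γf p q)

lemma4p6 : (P Q : FinPoset) → IsForest P →
    ((f : El P → Subset (size Q)) → IsProfunctor P Q f →
      ((∃ λ (g : El P → El Q) → IsMonotone P Q g × f ≤Pro α P Q g) ⇔ IsFiniteValued Q f))
    × ((m : Monomial P Q) → InMonomialIdeal P Q (LGens P Q) m ⇔ InMonomialIdeal P Q (LΓProFinGens P Q) m)
lemma4p6 P Q forest =
  (λ f f-profunctor →
     mk⇔ (below-α⇒isFiniteValued P Q) (isFiniteValued⇒below-α P Q forest f-profunctor)) ,
  (λ m → mk⇔ (InMonomialIdeal-⊆ P Q (LGens⊆LΓProFin P Q))
             (InMonomialIdeal-⊆ P Q (LΓProFinGens⊆L P Q forest)))
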